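{- Let $\mathcal{M}$ be an ordered $\lambda$-model satisfying the equations $\Theta xx = \Omega$ and $\Theta x\Omega = x$. Then for all closed $\lambda$-terms $P,Q$: (i) if $\mathcal{M}$ does not satisfy $\Theta PQ = \Omega$, then the interpretations of $P$ and $Q$ lie in distinct connected components of $\mathcal{M}$; (ii) the connected component of the interpretation of $\Omega$ is a singleton.
   Context: $\Omega \equiv (\lambda x.xx)(\lambda x.xx)$, $B \equiv \lambda x.x(\lambda y.yx)$, $C \equiv \lambda z.zB$, $\Theta \equiv BC$. A $\lambda$-model is a combinatory algebra $(A,\cdot,K,S)$ ($Kxy=x$, $Sxyz=xz(yz)$) satisfying, with $I\equiv SKK$, $\varepsilon\equiv\varepsilon_1\equiv S(KI)$, $\varepsilon_{n+1}\equiv S(K\varepsilon)(S(K\varepsilon_n))$: $\forall xy((\forall z.\ xz=yz)\Rightarrow\varepsilon x=\varepsilon y)$, $\varepsilon_2K=K$, $\varepsilon_3S=S$; $\lambda$-terms are interpreted in the standard way and an equation is satisfied if its sides have equal interpretation in every environment. An ordered $\lambda$-model is a $\lambda$-model with a partial order $\le$ making application monotone in both arguments; its connected components are the classes of the least equivalence relation containing $\le$. -}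

module Defs where

open import Level using (Level; _⊔_)
open import Data.Nat using (ℕ; zero; suc)
open import Data.Fin using (Fin; zero; suc)
open import Relation.Binary.PropositionalEquality using (_≡_)
open import Relation.Binary.Structures using (IsPartialOrder)
open import Relation.Binary.Construct.Closure.Equivalence using (EqClosure)

record CombinatoryAlgebra (ℓ : Level) : Set (Level.suc ℓ) where
  infixl 9 _·_
  field
    Carrier : Set ℓ
    _·_     : Carrier → Carrier → Carrier
    K S     : Carrier
    K-law   : ∀ x y → K · x · y ≡ x
    S-law   : ∀ x y z → S · x · y · z ≡ x · z · (y · z)

  I : Carrier
  I = S · K · K

  ε : Carrier
  ε = S · (K · I)

  -- ε₁ = ε, ε_{n+1} = S(Kε)(S(Kε_n)); εₙ n stands for ε_{n+1}
  εₙ : ℕ → Carrier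
  εₙ zero    = ε
  εₙ (suc n) = S · (K · ε) · (S · (K · εₙ n))

  ε₂ ε₃ : Carrier
  ε₂ = εₙ 1
  ε₃ = εₙ 2

record LambdaModel (ℓ : Level) : Set (Level.suc ℓ) where
  field
    ca : CombinatoryAlgebra ℓ
  open CombinatoryAlgebra ca public
  field
    weak-ext : ∀ x y → (∀ z → x · z ≡ y · z) → ε · x ≡ ε · y
    ε₂K      : ε₂ · K ≡ K
    ε₃S      : ε₃ · S ≡ S

record OrderedLambdaModel (ℓ ℓ' : Level) : Set (Level.suc (ℓ ⊔ ℓ')) where
  field
    lm : LambdaModel ℓ
  open LambdaModel lm public
  field
    _≤_       : Carrier → Carrier → Set ℓ'
    isPO      : IsPartialOrder _≡_ _≤_
    ·-mono    : ∀ {x x' y y'} → x ≤ x' → y ≤ y' → (x · y) ≤ (x' · y')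

  Connected : Carrier → Carrier → Set (ℓ ⊔ ℓ')
  Connected = EqClosure _≤_

data Term (n : ℕ) : Set where
  var : Fin n → Term n
  app : Term n → Term n → Term n
  lam : Term (ℕ.suc n) → Term n

data CL {ℓ} (A : Set ℓ) (n : ℕ) : Set ℓ where
  cvar  : Fin n → CL A n
  const : A → CL A n
  capp  : CL A n → CL A n → CL A n

module Interp {ℓ} (M : LambdaModel ℓ) where
  open LambdaModel M

  abs : ∀ {n} → CL Carrier (suc n) → CL Carrier n
  abs (cvar zero)    = const I
  abs (cvar (suc i)) = capp (const K) (cvar i)
  abs (const a)      = const (K · a)
  abs (capp P Q)     = capp (capp (const S) (abs P)) (abs Q)

  -- translation; λx.M ↦ ε · (λ*x.M) (choice-independent by weak extensionality)
  compile : ∀ {n} → Term n → CL Carrier n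
  compile (var i)   = cvar i
  compile (app P Q) = capp (compile P) (compile Q)
  compile (lam P)   = capp (const ε) (abs (compile P))

  evalCL : ∀ {n} → CL Carrier n → (Fin n → Carrier) → Carrier
  evalCL (cvar i)   ρ = ρ i
  evalCL (const a)  ρ = a
  evalCL (capp P Q) ρ = evalCL P ρ · evalCL Q ρ

  ⟦_⟧_ : ∀ {n} → Term n → (Fin n → Carrier) → Carrier
  ⟦ P ⟧ ρ = evalCL (compile P) ρ

  ⟦_⟧₀ : Term 0 → Carrier
  ⟦ P ⟧₀ = ⟦ P ⟧ (λ ())

  Satisfies : ∀ {n} → Term n → Term n → Set ℓ
  Satisfies P Q = ∀ ρ → ⟦ P ⟧ ρ ≡ ⟦ Q ⟧ ρ

x₀ : ∀ {n} → Term (suc n)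
x₀ = var zero

x₁ : ∀ {n} → Term (suc (suc n))
x₁ = var (suc zero)

ω : ∀ {n} → Term n
ω = lam (app x₀ x₀)

Ω : ∀ {n} → Term n
Ω = app ω ω

Bt : ∀ {n} → Term n
Bt = lam (app x₀ (lam (app x₀ x₁)))

Ct : ∀ {n} → Term n
Ct = lam (app x₀ Bt)

Θ : ∀ {n} → Term n
Θ = app Bt Ct

module Submission where

-- Write T = ⟦Θ⟧ and W = ⟦Ω⟧.  The two hypotheses say
-- that, for every a, the monotone map  T a  sends a to W and W to a.
-- An order-theoretic argument then shows that W is comparable only with
-- itself: from a ≤ W we get W = T a a ≤ T a W = a, and symmetrically.
-- A point related to nothing but itself is alone in its connected
-- component, which is part (ii).  For part (i), applying the monotone
-- map  T P  to a zigzag from P to Q yields a zigzag from T P P = W to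
-- T P Q, so T P Q = W by part (ii), i.e. the closed equation Θ P Q = Ω
-- holds.

open import Defs
open import Data.Fin using (Fin)
open import Data.Product using (_×_; _,_)
open import Relation.Nullary using (¬_)
open import Relation.Binary.Core using (Rel; _Preserves_⟶_)
open import Relation.Binary.Structures using (IsPartialOrder)
open import Relation.Binary.PropositionalEquality
  using (_≡_; refl; sym; trans; cong₂; subst₂)
open import Relation.Binary.Construct.Closure.Symmetric using (SymClosure; fwd; bwd)
open import Relation.Binary.Construct.Closure.ReflexiveTransitive using (ε; _◅_)
open import Relation.Binary.Construct.Closure.Equivalence
  using (EqClosure; symmetric; gmap)

swappable⇒isolated :
  ∀ {a r} {A : Set a} {_≤_ : Rel A r} → IsPartialOrder _≡_ _≤_ →
  (W : A) (swap : A → A → A) →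
  (∀ x → swap x Preserves _≤_ ⟶ _≤_) →
  (∀ x → swap x x ≡ W) → (∀ x → swap x W ≡ x) →
  ∀ {x} → SymClosure _≤_ x W → x ≡ W
swappable⇒isolated {_≤_ = _≤_} po W swap mono swap-xx swap-xW {x} (fwd x≤W) =
  antisym x≤W (subst₂ _≤_ (swap-xx x) (swap-xW x) (mono x x≤W))
  where open IsPartialOrder po
swappable⇒isolated {_≤_ = _≤_} po W swap mono swap-xx swap-xW {x} (bwd W≤x) =
  sym (antisym W≤x (subst₂ _≤_ (swap-xW x) (swap-xx x) (mono x W≤x)))
  where open IsPartialOrder po

isolated⇒singleton-component :
  ∀ {a r} {A : Set a} {R : Rel A r} {W : A} →
  (∀ {x} → SymClosure R x W → x ≡ W) →
  ∀ {x} → EqClosure R x W → x ≡ W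
isolated⇒singleton-component isolated ε = refl
isolated⇒singleton-component isolated (step ◅ path)
  with isolated⇒singleton-component isolated path
... | refl = isolated step

module _ {ℓ} (M : LambdaModel ℓ) where
  open LambdaModel M
  open Interp M

  closed-evalCL : (t : CL Carrier 0) (ρ ρ' : Fin 0 → Carrier) →
                  evalCL t ρ ≡ evalCL t ρ'
  closed-evalCL (const c)  ρ ρ' = refl
  closed-evalCL (capp t u) ρ ρ' = cong₂ _·_ (closed-evalCL t ρ ρ') (closed-evalCL u ρ ρ')

  closed-satisfies : (P Q : Term 0) → ⟦ P ⟧₀ ≡ ⟦ Q ⟧₀ → Satisfies P Q
  closed-satisfies P Q P≡Q ρ =
    trans (closed-evalCL (compile P) ρ (λ ()))
          (trans P≡Q (closed-evalCL (compile Q) (λ ()) ρ))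

lemma3p1 : ∀ {ℓ ℓ'} (𝓜 : OrderedLambdaModel ℓ ℓ') →
    let open OrderedLambdaModel 𝓜 in
    let open Interp lm in
    Satisfies {1} (app (app Θ x₀) x₀) Ω →
    Satisfies {1} (app (app Θ x₀) Ω) x₀ →
    ((P Q : Term 0) → ¬ Satisfies {0} (app (app Θ P) Q) Ω →
    ¬ Connected ⟦ P ⟧₀ ⟦ Q ⟧₀)
    × (∀ a → Connected a ⟦ Ω ⟧₀ → a ≡ ⟦ Ω ⟧₀)
lemma3p1 𝓜 ΘxxΩ ΘxΩx = separated , Ω-singleton
  where
  open OrderedLambdaModel 𝓜
  open Interp lm

  W : Carrier
  W = ⟦ Ω ⟧₀

  swap : Carrier → Carrier → Carrier
  swap x y = ⟦ Θ ⟧₀ · x · y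

  swap-mono : ∀ x → swap x Preserves _≤_ ⟶ _≤_
  swap-mono x = ·-mono (IsPartialOrder.refl isPO)

  swap-xx : ∀ x → swap x x ≡ W
  swap-xx x = ΘxxΩ (λ _ → x)

  swap-xW : ∀ x → swap x W ≡ x
  swap-xW x = ΘxΩx (λ _ → x)

  Ω-singleton : ∀ a → Connected a W → a ≡ W
  Ω-singleton a = isolated⇒singleton-component
    (swappable⇒isolated isPO W swap swap-mono swap-xx swap-xW)

  separated : (P Q : Term 0) → ¬ Satisfies (app (app Θ P) Q) Ω →
              ¬ Connected ⟦ P ⟧₀ ⟦ Q ⟧₀
  separated P Q ¬ΘPQ=Ω P~Q = ¬ΘPQ=Ω (closed-satisfies lm (app (app Θ P) Q) Ω ΘPQ≡W)
    where
    -- the image of a zigzag P ~ Q under the monotone map swap P is a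
    -- zigzag from swap P P = W to swap P Q
    W~ΘPQ : Connected W (swap ⟦ P ⟧₀ ⟦ Q ⟧₀)
    W~ΘPQ = subst₂ Connected (swap-xx ⟦ P ⟧₀) refl
      (gmap (swap ⟦ P ⟧₀) (swap-mono ⟦ P ⟧₀) P~Q)

    ΘPQ≡W : swap ⟦ P ⟧₀ ⟦ Q ⟧₀ ≡ W
    ΘPQ≡W = Ω-singleton (swap ⟦ P ⟧₀ ⟦ Q ⟧₀) (symmetric _≤_ W~ΘPQ)
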